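{- Let $P$ be a PLSC of order $n$. Suppose that some dots of $P$ can be eliminated (made empty) so that the resulting PLSC $P'$ is uniformly-distributed and has no eliminated files. Then $P$ satisfies the capacity condition: for all $I,J,K\subseteq\{1,\ldots,n\}$, the number of rooks of $P$ in $(I\times J\times K)\cup(I^c\times J^c\times K^c)$ is at most $\operatorname{cap}(n,|I|,|J|,|K|)$, where $I^c,J^c,K^c$ are the complements in $\{1,\ldots,n\}$.
   Context: A PLSC (partial Latin super cube) of order $n$ is an assignment to each cell of $\{1,\ldots,n\}^3$ of one of three states: rook, dot, or empty, such that no two rooks lie on a common line (a line, or file, is a set of $n$ cells obtained by fixing two coordinates), and such that no line containing a rook contains a dot. An eliminated file is a line containing neither a rook nor a dot. Form the graph whose vertices are the dots, two dots being adjacent iff they lie on a common line; the components of the dot structure are the connected components of this graph. A component is $k$-uniformly-distributed (for an integer $k>1$) if each line containing a dot of the component contains exactly $k$ dots; a PLSC is uniformly-distributed if every component of its dot structure is $k$-uniformly-distributed for some $k>1$ (the value of $k$ may vary from component to component). For a brick $T=I\times J\times K$, its remote mate is $I^c\times J^c\times K^c$, and $\operatorname{cap}(n,r,s,t)=rs-(n-t)(r+s-n)=rs+st+tr-n(r+s+t)+n^2$. -}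

module Defs where

open import Data.Nat using (ℕ; zero; suc; _+_; _<_; _∸_)
open import Data.Fin using (Fin)
open import Data.Fin.Subset using (Subset; _∈_; _∉_; ∣_∣)
open import Data.Bool using (Bool; true; false; _∧_; _∨_; if_then_else_)
open import Data.List using (List; map)
open import Data.Nat.ListAction using (sum)
open import Data.List using () renaming (allFin to finList)
open import Data.Product using (_×_; _,_; Σ; ∃)
open import Data.Sum using (_⊎_)
open import Data.Integer as ℤ using (ℤ; +_)
open import Relation.Binary.PropositionalEquality using (_≡_; _≢_)
open import Relation.Binary.Construct.Closure.ReflexiveTransitive using (Star)
open import Data.Vec using (lookup)
open import Relation.Nullary using (¬_)

data State : Set where
  rook dot empty : State

Pos : ℕ → Set
Pos n = Fin n × Fin n × Fin n

Config : ℕ → Set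
Config n = Pos n → State

-- Lines (files): a direction and the two fixed coordinates.
data Dir : Set where
  d₁ d₂ d₃ : Dir

Line : ℕ → Set
Line n = Dir × Fin n × Fin n

lineCell : ∀ {n} → Line n → Fin n → Pos n
lineCell (d₁ , a , b) x = (x , a , b)
lineCell (d₂ , a , b) x = (a , x , b)
lineCell (d₃ , a , b) x = (a , b , x)

count : ∀ {n} → (Fin n → Bool) → ℕ
count {n} p = sum (map (λ x → if p x then 1 else 0) (finList n))

isRook : State → Bool
isRook rook = true
isRook _    = false

isDot : State → Bool
isDot dot = true
isDot _   = false

IsPLSC : ∀ {n} → Config n → Set
IsPLSC {n} P =
  (∀ (L : Line n) (x y : Fin n) → P (lineCell L x) ≡ rook → P (lineCell L y) ≡ rook → x ≡ y)
  × (∀ (L : Line n) (x y : Fin n) → P (lineCell L x) ≡ rook → P (lineCell L y) ≢ dot)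

dotsOn : ∀ {n} → Config n → Line n → ℕ
dotsOn P L = count (λ x → isDot (P (lineCell L x)))

DotAdj : ∀ {n} → Config n → Pos n → Pos n → Set
DotAdj {n} P c e = P c ≡ dot × P e ≡ dot
  × Σ (Line n) (λ L → Σ (Fin n) (λ x → Σ (Fin n) (λ y → lineCell L x ≡ c × lineCell L y ≡ e)))

SameComponent : ∀ {n} → Config n → Pos n → Pos n → Set
SameComponent P = Star (DotAdj P)

KUniform : ∀ {n} → Config n → ℕ → Pos n → Set
KUniform {n} P k c = ∀ (e : Pos n) → P e ≡ dot → SameComponent P c e →
  ∀ (L : Line n) (x : Fin n) → lineCell L x ≡ e → dotsOn P L ≡ k

UniformlyDistributed : ∀ {n} → Config n → Set
UniformlyDistributed {n} P = ∀ (c : Pos n) → P c ≡ dot → ∃ λ k → 1 < k × KUniform P k c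

Eliminated : ∀ {n} → Config n → Line n → Set
Eliminated {n} P L = ∀ (x : Fin n) → P (lineCell L x) ≢ rook × P (lineCell L x) ≢ dot

NoEliminatedFiles : ∀ {n} → Config n → Set
NoEliminatedFiles {n} P = ∀ (L : Line n) → ¬ Eliminated P L

ObtainedByEliminatingDots : ∀ {n} → Config n → Config n → Set
ObtainedByEliminatingDots {n} P P' =
  ∀ (c : Pos n) → P' c ≡ P c ⊎ (P c ≡ dot × P' c ≡ empty)

mem : ∀ {n} → Subset n → Fin n → Bool
mem I i = lookup I i

not : Bool → Bool
not true = false
not false = true

inBrickOrMate : ∀ {n} → Subset n → Subset n → Subset n → Pos n → Bool
inBrickOrMate I J K (i , j , k) =
  (mem I i ∧ mem J j ∧ mem K k) ∨ (not (mem I i) ∧ not (mem J j) ∧ not (mem K k))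

rooksIn : ∀ {n} → Config n → Subset n → Subset n → Subset n → ℕ
rooksIn {n} P I J K =
  sum (map (λ i → sum (map (λ j →
    count (λ k → isRook (P (i , j , k)) ∧ inBrickOrMate I J K (i , j , k)))
    (finList n))) (finList n))

cap : ℕ → ℕ → ℕ → ℕ → ℤ
cap n r s t = (+ r ℤ.* + s) ℤ.- ((+ n ℤ.- + t) ℤ.* ((+ r ℤ.+ + s) ℤ.- + n))

CapacityCondition : ∀ {n} → Config n → Set
CapacityCondition {n} P = ∀ (I J K : Subset n) →
  + (rooksIn P I J K) ℤ.≤ cap n (∣ I ∣) (∣ J ∣) (∣ K ∣)

{-# OPTIONS --safe #-}

-- Give each rook of P′ weight n! and each dot weight n!/k, where k is the number of dots on
-- any line through it (uniformity makes k independent of the line). Without eliminated files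
-- every line of P′ then carries total weight exactly n!. The indicator of a brick together
-- with its remote mate is 1 − x − y − z + xy + yz + zx, each term depending on at most two
-- coordinates, so the total weight on the brick and its mate is n! · cap(n,|I|,|J|,|K|).
-- The rooks of P are rooks of P′ of weight n! each, which bounds their number.

module Submission where

open import Defs
open import Data.Nat using (ℕ)
open import Data.Product using (_×_; Σ)

import Data.Nat.Properties as ℕP
open import Algebra.Properties.Semiring.Sum ℕP.+-*-semiring
  using (sum; sum-syntax; sum-cong-≗; sum-remove; sum-replicate-zero;
         ∑-distrib-+; ∑-comm; *-distribˡ-sum; *-distribʳ-sum)
open import Data.Bool using (Bool; true; false; _∧_; _∨_; if_then_else_)
open import Data.Empty using (⊥-elim)
open import Data.Fin using (Fin; zero; suc; punchIn)
open import Data.Fin.Properties using (any?; punchInᵢ≢i)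
open import Data.Fin.Subset using (Subset; ∣_∣)
import Data.Integer as ℤ
import Data.Integer.Properties as ℤP
open import Data.Integer.Tactic.RingSolver using (solve-∀)
open import Data.List using (map; tabulate; allFin)
open import Data.List.Properties using (map-tabulate)
open import Data.Nat using (zero; suc; _+_; _*_; _≤_; _<_; z≤n; _!; NonZero)
open import Data.Nat.Divisibility using (∣-trans; m∣m*n; m≤n⇒m!∣n!)
open import Data.Nat.DivMod using (_/_; m*[n/m]≡n)
open import Data.Nat.ListAction using () renaming (sum to sumˡ)
open import Data.Product using (_,_; proj₁; proj₂)
open import Data.Sum using (inj₁; inj₂)
open import Data.Vec using ([]; _∷_; lookup)
open import Function using (id; _∘_)
open import Relation.Binary.Definitions using (DecidableEquality)
open import Relation.Binary.PropositionalEquality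
open import Relation.Binary.Construct.Closure.ReflexiveTransitive using (ε)
open import Relation.Nullary using (yes; no)

indicator : Bool → ℕ
indicator b = if b then 1 else 0

∑-mono-≤ : ∀ {n} {f g : Fin n → ℕ} → (∀ i → f i ≤ g i) → sum f ≤ sum g
∑-mono-≤ {zero}  _   = z≤n
∑-mono-≤ {suc n} f≤g = ℕP.+-mono-≤ (f≤g zero) (∑-mono-≤ (f≤g ∘ suc))

∑-ones : ∀ n → ∑[ i < n ] 1 ≡ n
∑-ones zero    = refl
∑-ones (suc n) = cong suc (∑-ones n)

∑-indicator-≤ : ∀ {n} (p : Fin n → Bool) → ∑[ i < n ] indicator (p i) ≤ n
∑-indicator-≤ {n} p = subst (∑[ i < n ] indicator (p i) ≤_) (∑-ones n) (∑-mono-≤ (indicator≤1 ∘ p))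
  where
  indicator≤1 : ∀ b → indicator b ≤ 1
  indicator≤1 true  = ℕP.≤-refl
  indicator≤1 false = z≤n

∑-subset : ∀ {n} (I : Subset n) → ∑[ i < n ] indicator (lookup I i) ≡ ∣ I ∣
∑-subset []          = refl
∑-subset (true ∷ I)  = cong suc (∑-subset I)
∑-subset (false ∷ I) = ∑-subset I

∑-single : ∀ {n} (f : Fin n → ℕ) (i : Fin n) → (∀ j → j ≢ i → f j ≡ 0) → sum f ≡ f i
∑-single {suc n} f i others-zero = begin
  sum f                            ≡⟨ sum-remove {i = i} f ⟩
  f i + ∑[ j < n ] f (punchIn i j)
    ≡⟨ cong (f i +_) (sum-cong-≗ (λ j → others-zero _ (punchInᵢ≢i i j))) ⟩
  f i + ∑[ j < n ] 0               ≡⟨ cong (f i +_) (sum-replicate-zero n) ⟩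
  f i + 0                          ≡⟨ ℕP.+-identityʳ (f i) ⟩
  f i                              ∎
  where
  open ≡-Reasoning

∑-product : ∀ {n} (f g : Fin n → ℕ) → ∑[ a < n ] ∑[ b < n ] (f a * g b) ≡ sum f * sum g
∑-product f g =
  trans (sum-cong-≗ (λ a → sym (*-distribˡ-sum (f a) g))) (sym (*-distribʳ-sum (sum g) f))

sumˡ-allFin : ∀ n (f : Fin n → ℕ) → sumˡ (map f (allFin n)) ≡ sum f
sumˡ-allFin n f = trans (cong sumˡ (map-tabulate id f)) (sumˡ-tabulate f)
  where
  sumˡ-tabulate : ∀ {m} (g : Fin m → ℕ) → sumˡ (tabulate g) ≡ sum g
  sumˡ-tabulate {zero}  g = refl
  sumˡ-tabulate {suc m} g = cong (g zero +_) (sumˡ-tabulate (g ∘ suc))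

count≡∑ : ∀ {n} (p : Fin n → Bool) → count p ≡ ∑[ i < n ] indicator (p i)
count≡∑ {n} p = sumˡ-allFin n (indicator ∘ p)

∑³ : ∀ {n} → (Fin n → Fin n → Fin n → ℕ) → ℕ
∑³ {n} F = ∑[ i < n ] ∑[ j < n ] ∑[ k < n ] F i j k

module _ {n : ℕ} where

  ∑³-cong : {F G : Fin n → Fin n → Fin n → ℕ} → (∀ i j k → F i j k ≡ G i j k) → ∑³ F ≡ ∑³ G
  ∑³-cong F≡G = sum-cong-≗ (λ i → sum-cong-≗ (λ j → sum-cong-≗ (F≡G i j)))

  ∑³-mono-≤ : {F G : Fin n → Fin n → Fin n → ℕ} → (∀ i j k → F i j k ≤ G i j k) → ∑³ F ≤ ∑³ G
  ∑³-mono-≤ F≤G = ∑-mono-≤ (λ i → ∑-mono-≤ (λ j → ∑-mono-≤ (F≤G i j)))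

  ∑³-distrib-+ : (F G : Fin n → Fin n → Fin n → ℕ) →
    ∑³ (λ i j k → F i j k + G i j k) ≡ ∑³ F + ∑³ G
  ∑³-distrib-+ F G = begin
    ∑³ (λ i j k → F i j k + G i j k)
      ≡⟨ sum-cong-≗ (λ i → sum-cong-≗ (λ j → ∑-distrib-+ (F i j) (G i j))) ⟩
    ∑[ i < n ] ∑[ j < n ] (sum (F i j) + sum (G i j))
      ≡⟨ sum-cong-≗ (λ i → ∑-distrib-+ (sum ∘ F i) (sum ∘ G i)) ⟩
    ∑[ i < n ] (∑[ j < n ] sum (F i j) + ∑[ j < n ] sum (G i j))
      ≡⟨ ∑-distrib-+ (λ i → ∑[ j < n ] sum (F i j)) (λ i → ∑[ j < n ] sum (G i j)) ⟩
    ∑³ F + ∑³ G ∎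
    where open ≡-Reasoning

  ∑³-*ʳ : (F : Fin n → Fin n → Fin n → ℕ) (c : ℕ) → ∑³ (λ i j k → F i j k * c) ≡ ∑³ F * c
  ∑³-*ʳ F c = sym (begin
    ∑³ F * c
      ≡⟨ *-distribʳ-sum c (λ i → ∑[ j < n ] sum (F i j)) ⟩
    ∑[ i < n ] (∑[ j < n ] sum (F i j) * c)
      ≡⟨ sum-cong-≗ (λ i → *-distribʳ-sum c (sum ∘ F i)) ⟩
    ∑[ i < n ] ∑[ j < n ] (sum (F i j) * c)
      ≡⟨ sum-cong-≗ (λ i → sum-cong-≗ (λ j → *-distribʳ-sum c (F i j))) ⟩
    ∑³ (λ i j k → F i j k * c) ∎)
    where open ≡-Reasoning

  ∑³-rotate : (F : Fin n → Fin n → Fin n → ℕ) → ∑³ F ≡ ∑³ (λ j k i → F i j k)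
  ∑³-rotate F =
    trans (∑-comm (λ i j → sum (F i j))) (sum-cong-≗ (λ j → ∑-comm (λ i k → F i j k)))

  ∑³-swap₂₃ : (F : Fin n → Fin n → Fin n → ℕ) → ∑³ F ≡ ∑³ (λ i k j → F i j k)
  ∑³-swap₂₃ F = sum-cong-≗ (λ i → ∑-comm (F i))

  ∑³-product-weighted : (w : Fin n → Fin n → Fin n → ℕ) {N : ℕ} →
    (∀ a b → sum (w a b) ≡ N) → (f g : Fin n → ℕ) →
    ∑³ (λ a b c → f a * g b * w a b c) ≡ sum f * sum g * N
  ∑³-product-weighted w {N} line f g = begin
    ∑³ (λ a b c → f a * g b * w a b c)
      ≡⟨ sum-cong-≗ (λ a → sum-cong-≗ (λ b →
           trans (sym (*-distribˡ-sum (f a * g b) (w a b))) (cong (f a * g b *_) (line a b)))) ⟩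
    ∑[ a < n ] ∑[ b < n ] (f a * g b * N)
      ≡⟨ sum-cong-≗ (λ a → sym (*-distribʳ-sum N (λ b → f a * g b))) ⟩
    ∑[ a < n ] (∑[ b < n ] (f a * g b) * N)
      ≡⟨ sym (*-distribʳ-sum N (λ a → ∑[ b < n ] (f a * g b))) ⟩
    ∑[ a < n ] ∑[ b < n ] (f a * g b) * N
      ≡⟨ cong (_* N) (∑-product f g) ⟩
    sum f * sum g * N ∎
    where open ≡-Reasoning

LineSumsTo : ∀ {n} → (Pos n → ℕ) → ℕ → Set
LineSumsTo {n} w N = ∀ (L : Line n) → ∑[ x < n ] w (lineCell L x) ≡ N

-- Inclusion–exclusion for the brick and its remote mate, with the negative terms moved across.
brickOrMate-expansion : ∀ x y z →
  indicator ((x ∧ y ∧ z) ∨ (not x ∧ not y ∧ not z))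
    + (indicator x * 1 + 1 * indicator y + 1 * indicator z)
  ≡ 1 * 1 + indicator x * indicator y + indicator y * indicator z + indicator x * indicator z
brickOrMate-expansion true  true  true  = refl
brickOrMate-expansion true  true  false = refl
brickOrMate-expansion true  false true  = refl
brickOrMate-expansion true  false false = refl
brickOrMate-expansion false true  true  = refl
brickOrMate-expansion false true  false = refl
brickOrMate-expansion false false true  = refl
brickOrMate-expansion false false false = refl

*-distribʳ-+₃ : ∀ c a b d → (a + b + d) * c ≡ a * c + b * c + d * c
*-distribʳ-+₃ c a b d =
  trans (ℕP.*-distribʳ-+ c (a + b) d) (cong (_+ d * c) (ℕP.*-distribʳ-+ c a b))

*-distribʳ-+₄ : ∀ c a b d e → (a + b + d + e) * c ≡ a * c + b * c + d * c + e * c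
*-distribʳ-+₄ c a b d e =
  trans (ℕP.*-distribʳ-+ c (a + b + d) e) (cong (_+ e * c) (*-distribʳ-+₃ c a b d))

module _ {n : ℕ} {w : Pos n → ℕ} {N : ℕ} (lines : LineSumsTo w N) where

  private
    w³ : Fin n → Fin n → Fin n → ℕ
    w³ i j k = w (i , j , k)

  weighted-ij : (f g : Fin n → ℕ) → ∑³ (λ i j k → f i * g j * w³ i j k) ≡ sum f * sum g * N
  weighted-ij = ∑³-product-weighted w³ (λ i j → lines (d₃ , i , j))

  weighted-jk : (f g : Fin n → ℕ) → ∑³ (λ i j k → f j * g k * w³ i j k) ≡ sum f * sum g * N
  weighted-jk f g = trans (∑³-rotate (λ i j k → f j * g k * w³ i j k))
    (∑³-product-weighted (λ j k i → w³ i j k) (λ j k → lines (d₁ , j , k)) f g)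

  weighted-ik : (f g : Fin n → ℕ) → ∑³ (λ i j k → f i * g k * w³ i j k) ≡ sum f * sum g * N
  weighted-ik f g = trans (∑³-swap₂₃ (λ i j k → f i * g k * w³ i j k))
    (∑³-product-weighted (λ i k j → w³ i j k) (λ i k → lines (d₂ , i , k)) f g)

  brickOrMate-weight : (I J K : Subset n) →
    let r = ∣ I ∣; s = ∣ J ∣; t = ∣ K ∣ in
    ∑³ (λ i j k → indicator (inBrickOrMate I J K (i , j , k)) * w (i , j , k))
      + (r * n + n * s + n * t) * N
    ≡ (n * n + r * s + s * t + r * t) * N
  brickOrMate-weight I J K = begin
    S + (r * n + n * s + n * t) * N
      ≡⟨ cong (S +_) (trans (*-distribʳ-+₃ N (r * n) (n * s) (n * t))
           (sym (cong₂ _+_ (cong₂ _+_ ∑t₁ ∑t₂) ∑t₃))) ⟩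
    S + (∑³ t₁ + ∑³ t₂ + ∑³ t₃)
      ≡⟨ sym (trans (∑³-distrib-+ B (λ i j k → t₁ i j k + t₂ i j k + t₃ i j k))
           (cong (S +_) (trans (∑³-distrib-+ (λ i j k → t₁ i j k + t₂ i j k) t₃)
             (cong (_+ ∑³ t₃) (∑³-distrib-+ t₁ t₂))))) ⟩
    ∑³ (λ i j k → B i j k + (t₁ i j k + t₂ i j k + t₃ i j k))
      ≡⟨ ∑³-cong cell ⟩
    ∑³ (λ i j k → u₀ i j k + u₁ i j k + u₂ i j k + u₃ i j k)
      ≡⟨ trans (∑³-distrib-+ (λ i j k → u₀ i j k + u₁ i j k + u₂ i j k) u₃)
           (cong (_+ ∑³ u₃) (trans (∑³-distrib-+ (λ i j k → u₀ i j k + u₁ i j k) u₂)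
             (cong (_+ ∑³ u₂) (∑³-distrib-+ u₀ u₁)))) ⟩
    ∑³ u₀ + ∑³ u₁ + ∑³ u₂ + ∑³ u₃
      ≡⟨ cong₂ _+_ (cong₂ _+_ (cong₂ _+_ ∑u₀ ∑u₁) ∑u₂) ∑u₃ ⟩
    n * n * N + r * s * N + s * t * N + r * t * N
      ≡⟨ sym (*-distribʳ-+₄ N (n * n) (r * s) (s * t) (r * t)) ⟩
    (n * n + r * s + s * t + r * t) * N ∎
    where
    open ≡-Reasoning
    r = ∣ I ∣
    s = ∣ J ∣
    t = ∣ K ∣
    χI χJ χK one : Fin n → ℕ
    χI i = indicator (lookup I i)
    χJ j = indicator (lookup J j)
    χK k = indicator (lookup K k)
    one _ = 1

    B t₁ t₂ t₃ u₀ u₁ u₂ u₃ : Fin n → Fin n → Fin n → ℕ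
    B i j k = indicator (inBrickOrMate I J K (i , j , k)) * w³ i j k
    t₁ i j k = χI i * one j * w³ i j k
    t₂ i j k = one i * χJ j * w³ i j k
    t₃ i j k = one j * χK k * w³ i j k
    u₀ i j k = one i * one j * w³ i j k
    u₁ i j k = χI i * χJ j * w³ i j k
    u₂ i j k = χJ j * χK k * w³ i j k
    u₃ i j k = χI i * χK k * w³ i j k

    S : ℕ
    S = ∑³ B

    evaluate : ∀ {f g : Fin n → ℕ} {a b} → sum f ≡ a → sum g ≡ b → sum f * sum g * N ≡ a * b * N
    evaluate = cong₂ (λ a b → a * b * N)

    ∑t₁ : ∑³ t₁ ≡ r * n * N
    ∑t₁ = trans (weighted-ij χI one) (evaluate (∑-subset I) (∑-ones n))
    ∑t₂ : ∑³ t₂ ≡ n * s * N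
    ∑t₂ = trans (weighted-ij one χJ) (evaluate (∑-ones n) (∑-subset J))
    ∑t₃ : ∑³ t₃ ≡ n * t * N
    ∑t₃ = trans (weighted-jk one χK) (evaluate (∑-ones n) (∑-subset K))
    ∑u₀ : ∑³ u₀ ≡ n * n * N
    ∑u₀ = trans (weighted-ij one one) (evaluate (∑-ones n) (∑-ones n))
    ∑u₁ : ∑³ u₁ ≡ r * s * N
    ∑u₁ = trans (weighted-ij χI χJ) (evaluate (∑-subset I) (∑-subset J))
    ∑u₂ : ∑³ u₂ ≡ s * t * N
    ∑u₂ = trans (weighted-jk χJ χK) (evaluate (∑-subset J) (∑-subset K))
    ∑u₃ : ∑³ u₃ ≡ r * t * N
    ∑u₃ = trans (weighted-ik χI χK) (evaluate (∑-subset I) (∑-subset K))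

    cell : ∀ i j k → B i j k + (t₁ i j k + t₂ i j k + t₃ i j k) ≡ u₀ i j k + u₁ i j k + u₂ i j k + u₃ i j k
    cell i j k = begin
      B i j k + (t₁ i j k + t₂ i j k + t₃ i j k)
        ≡⟨ cong (B i j k +_) (sym (*-distribʳ-+₃ c (χI i * 1) (1 * χJ j) (1 * χK k))) ⟩
      B i j k + (χI i * 1 + 1 * χJ j + 1 * χK k) * c
        ≡⟨ sym (ℕP.*-distribʳ-+ c (indicator (inBrickOrMate I J K (i , j , k))) _) ⟩
      (indicator (inBrickOrMate I J K (i , j , k)) + (χI i * 1 + 1 * χJ j + 1 * χK k)) * c
        ≡⟨ cong (_* c) (brickOrMate-expansion (lookup I i) (lookup J j) (lookup K k)) ⟩
      (1 * 1 + χI i * χJ j + χJ j * χK k + χI i * χK k) * c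
        ≡⟨ *-distribʳ-+₄ c (1 * 1) (χI i * χJ j) (χJ j * χK k) (χI i * χK k) ⟩
      u₀ i j k + u₁ i j k + u₂ i j k + u₃ i j k ∎
      where c = w³ i j k

rooksIn≡∑³ : ∀ {n} (P : Config n) (I J K : Subset n) →
  rooksIn P I J K ≡ ∑³ (λ i j k → indicator (isRook (P (i , j , k)) ∧ inBrickOrMate I J K (i , j , k)))
rooksIn≡∑³ {n} P I J K =
  trans (sumˡ-allFin n (λ i → sumˡ (map (row i) (allFin n))))
    (sum-cong-≗ (λ i → trans (sumˡ-allFin n (row i)) (sum-cong-≗ (λ j → count≡∑ (rook-in i j)))))
  where
  rook-in : Fin n → Fin n → Fin n → Bool
  rook-in i j k = isRook (P (i , j , k)) ∧ inBrickOrMate I J K (i , j , k)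
  row : Fin n → Fin n → ℕ
  row i j = count (rook-in i j)

rook-indicator-≤ : ∀ {N w} (s : State) (b : Bool) → (s ≡ rook → N ≤ w) →
  indicator (isRook s ∧ b) * N ≤ indicator b * w
rook-indicator-≤ rook  true  N≤w = ℕP.+-monoˡ-≤ 0 (N≤w refl)
rook-indicator-≤ rook  false _   = z≤n
rook-indicator-≤ dot   _     _   = z≤n
rook-indicator-≤ empty _     _   = z≤n

cap-as-difference : ∀ n r s t →
  ℤ.+ (n * n + r * s + s * t + r * t) ℤ.- ℤ.+ (r * n + n * s + n * t) ≡ cap n r s t
cap-as-difference n r s t =
  trans (cong₂ ℤ._-_ Y-homo X-homo) (polynomial (ℤ.+ n) (ℤ.+ r) (ℤ.+ s) (ℤ.+ t))
  where
  open ℤP using (pos-+; pos-*)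
  Y-homo : ℤ.+ (n * n + r * s + s * t + r * t)
         ≡ ℤ.+ n ℤ.* ℤ.+ n ℤ.+ ℤ.+ r ℤ.* ℤ.+ s ℤ.+ ℤ.+ s ℤ.* ℤ.+ t ℤ.+ ℤ.+ r ℤ.* ℤ.+ t
  Y-homo = trans (pos-+ _ (r * t)) (cong₂ ℤ._+_ (trans (pos-+ _ (s * t)) (cong₂ ℤ._+_
    (trans (pos-+ (n * n) (r * s)) (cong₂ ℤ._+_ (pos-* n n) (pos-* r s))) (pos-* s t))) (pos-* r t))
  X-homo : ℤ.+ (r * n + n * s + n * t) ≡ ℤ.+ r ℤ.* ℤ.+ n ℤ.+ ℤ.+ n ℤ.* ℤ.+ s ℤ.+ ℤ.+ n ℤ.* ℤ.+ t
  X-homo = trans (pos-+ _ (n * t)) (cong₂ ℤ._+_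
    (trans (pos-+ (r * n) (n * s)) (cong₂ ℤ._+_ (pos-* r n) (pos-* n s))) (pos-* n t))
  polynomial : ∀ n r s t →
    (n ℤ.* n ℤ.+ r ℤ.* s ℤ.+ s ℤ.* t ℤ.+ r ℤ.* t) ℤ.- (r ℤ.* n ℤ.+ n ℤ.* s ℤ.+ n ℤ.* t)
    ≡ r ℤ.* s ℤ.- (n ℤ.- t) ℤ.* ((r ℤ.+ s) ℤ.- n)
  polynomial = solve-∀

cap-lower-bound : ∀ n r s t R →
  R + (r * n + n * s + n * t) ≤ n * n + r * s + s * t + r * t → ℤ.+ R ℤ.≤ cap n r s t
cap-lower-bound n r s t R R+X≤Y = begin
  ℤ.+ R                            ≡⟨ m≡m+n-n (ℤ.+ R) (ℤ.+ X) ⟩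
  ℤ.+ R ℤ.+ ℤ.+ X ℤ.- ℤ.+ X        ≡⟨ cong (ℤ._- ℤ.+ X) (sym (ℤP.pos-+ R X)) ⟩
  ℤ.+ (R + X) ℤ.- ℤ.+ X            ≤⟨ ℤP.+-monoˡ-≤ (ℤ.- ℤ.+ X) (ℤ.+≤+ R+X≤Y) ⟩
  ℤ.+ Y ℤ.- ℤ.+ X                  ≡⟨ cap-as-difference n r s t ⟩
  cap n r s t                      ∎
  where
  open ℤP.≤-Reasoning
  X = r * n + n * s + n * t
  Y = n * n + r * s + s * t + r * t
  m≡m+n-n : ∀ a b → a ≡ a ℤ.+ b ℤ.- b
  m≡m+n-n = solve-∀

capacity-from-weighting : ∀ {n} (P : Config n) (w : Pos n → ℕ) (N : ℕ) .{{_ : NonZero N}} →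
  LineSumsTo w N → (∀ c → P c ≡ rook → N ≤ w c) → CapacityCondition P
capacity-from-weighting {n} P w N lines rook≤w I J K =
  cap-lower-bound n (∣ I ∣) (∣ J ∣) (∣ K ∣) R (ℕP.*-cancelʳ-≤ (R + X) Y N (begin
    (R + X) * N    ≡⟨ ℕP.*-distribʳ-+ N R X ⟩
    R * N + X * N  ≤⟨ ℕP.+-monoˡ-≤ (X * N) RN≤S ⟩
    S + X * N      ≡⟨ brickOrMate-weight lines I J K ⟩
    Y * N          ∎))
  where
  open ℕP.≤-Reasoning
  R = rooksIn P I J K
  X = ∣ I ∣ * n + n * ∣ J ∣ + n * ∣ K ∣
  Y = n * n + ∣ I ∣ * ∣ J ∣ + ∣ J ∣ * ∣ K ∣ + ∣ I ∣ * ∣ K ∣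
  rook-in : Fin n → Fin n → Fin n → ℕ
  rook-in i j k = indicator (isRook (P (i , j , k)) ∧ inBrickOrMate I J K (i , j , k))
  S = ∑³ (λ i j k → indicator (inBrickOrMate I J K (i , j , k)) * w (i , j , k))
  RN≤S : R * N ≤ S
  RN≤S = begin
    R * N                               ≡⟨ cong (_* N) (rooksIn≡∑³ P I J K) ⟩
    ∑³ rook-in * N                      ≡⟨ ∑³-*ʳ rook-in N ⟨
    ∑³ (λ i j k → rook-in i j k * N)
      ≤⟨ ∑³-mono-≤ (λ i j k → rook-indicator-≤ (P (i , j , k)) _ (rook≤w (i , j , k))) ⟩
    S                                   ∎

_≟_ : DecidableEquality State
rook  ≟ rook  = yes refl
rook  ≟ dot   = no (λ ())
rook  ≟ empty = no (λ ())
dot   ≟ rook  = no (λ ())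
dot   ≟ dot   = yes refl
dot   ≟ empty = no (λ ())
empty ≟ rook  = no (λ ())
empty ≟ dot   = no (λ ())
empty ≟ empty = yes refl

rook-preserved : ∀ {n} {P P′ : Config n} → ObtainedByEliminatingDots P P′ →
  ∀ c → P c ≡ rook → P′ c ≡ rook
rook-preserved elim c rook-c with elim c
... | inj₁ P′c≡Pc = trans P′c≡Pc rook-c
... | inj₂ (dot-c , _) with trans (sym rook-c) dot-c
...   | ()

module UniformWeighting {n : ℕ} (P : Config n) (plsc : IsPLSC P)
  (uniform : UniformlyDistributed P) (no-eliminated : NoEliminatedFiles P) where

  N : ℕ
  N = n !

  share : ℕ → ℕ
  share zero    = 0
  share (suc k) = N / suc k

  share-spec : ∀ k → 0 < k → k ≤ n → k * share k ≡ N
  share-spec (suc k) _ k<n = m*[n/m]≡n (∣-trans (m∣m*n (k !)) (m≤n⇒m!∣n! k<n))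

  d₁-line : Pos n → Line n
  d₁-line (_ , j , k) = d₁ , j , k

  stateWeight : State → ℕ → ℕ
  stateWeight rook  _ = N
  stateWeight dot   k = share k
  stateWeight empty _ = 0

  weight : Pos n → ℕ
  weight c = stateWeight (P c) (dotsOn P (d₁-line c))

  weight-rook : ∀ c → P c ≡ rook → weight c ≡ N
  weight-rook c rook-c rewrite rook-c = refl

  dot-line-uniform : ∀ L x → P (lineCell L x) ≡ dot →
    1 < dotsOn P L × dotsOn P L ≡ dotsOn P (d₁-line (lineCell L x))
  dot-line-uniform L x dot-x with uniform (lineCell L x) dot-x
  ... | k , 1<k , k-uniform =
    subst (1 <_) (sym on-L) 1<k , trans on-L (sym (k-uniform _ dot-x ε (d₁-line c) (proj₁ c) refl))
    where
    c = lineCell L x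
    on-L = k-uniform c dot-x ε L x refl

  rook-line : ∀ L x → P (lineCell L x) ≡ rook → ∑[ y < n ] weight (lineCell L y) ≡ N
  rook-line L x rook-x = trans (∑-single _ x others-empty) (weight-rook _ rook-x)
    where
    others-empty : ∀ y → y ≢ x → weight (lineCell L y) ≡ 0
    others-empty y y≢x with P (lineCell L y) in eq
    ... | rook  = ⊥-elim (y≢x (proj₁ plsc L y x eq rook-x))
    ... | dot   = ⊥-elim (proj₂ plsc L x y rook-x eq)
    ... | empty = refl

  rookless-line : ∀ L x → (∀ y → P (lineCell L y) ≢ rook) → P (lineCell L x) ≡ dot →
    ∑[ y < n ] weight (lineCell L y) ≡ N
  rookless-line L x no-rook dot-x = begin
    ∑[ y < n ] weight (lineCell L y)  ≡⟨ sum-cong-≗ dot-share ⟩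
    ∑[ y < n ] (dot-at y * share k)   ≡⟨ *-distribʳ-sum (share k) dot-at ⟨
    ∑[ y < n ] dot-at y * share k     ≡⟨ cong (_* share k) (count≡∑ dotted) ⟨
    k * share k                       ≡⟨ share-spec k (ℕP.<-trans (ℕP.n<1+n 0) 1<k) k≤n ⟩
    N                                 ∎
    where
    open ≡-Reasoning
    dotted : Fin n → Bool
    dotted = isDot ∘ P ∘ lineCell L
    dot-at : Fin n → ℕ
    dot-at = indicator ∘ dotted
    k = dotsOn P L
    1<k = proj₁ (dot-line-uniform L x dot-x)
    k≤n : k ≤ n
    k≤n = subst (_≤ n) (sym (count≡∑ dotted)) (∑-indicator-≤ dotted)
    dot-share : ∀ y → weight (lineCell L y) ≡ dot-at y * share k
    dot-share y with P (lineCell L y) in eq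
    ... | rook  = ⊥-elim (no-rook y eq)
    ... | dot   =
      trans (cong share (sym (proj₂ (dot-line-uniform L y eq)))) (sym (ℕP.+-identityʳ (share k)))
    ... | empty = refl

  weight-lineSum : LineSumsTo weight N
  weight-lineSum L with any? (λ x → P (lineCell L x) ≟ rook)
  ... | yes (x , rook-x) = rook-line L x rook-x
  ... | no no-rook with any? (λ x → P (lineCell L x) ≟ dot)
  ...   | yes (x , dot-x) = rookless-line L x (λ y rook-y → no-rook (y , rook-y)) dot-x
  ...   | no no-dot =
    ⊥-elim (no-eliminated L (λ y → (λ rook-y → no-rook (y , rook-y)) , (λ dot-y → no-dot (y , dot-y))))

mainTheorem8 : ∀ (n : ℕ) (P : Config n) → IsPLSC P →
    Σ (Config n) (λ P' → ObtainedByEliminatingDots P P' × IsPLSC P' × UniformlyDistributed P' × NoEliminatedFiles P') →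
    CapacityCondition P
mainTheorem8 n P _ (P′ , eliminated , plsc′ , uniform′ , no-eliminated′) =
  capacity-from-weighting P weight N {{n !≢0}} weight-lineSum
    (λ c rook-c → ℕP.≤-reflexive (sym (weight-rook c (rook-preserved eliminated c rook-c))))
  where
  open UniformWeighting P′ plsc′ uniform′ no-eliminated′
  open ℕP using (_!≢0)
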